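{- Let $n\ge 11$ and $k$ be positive integers and let $d=n-(2k-1)$ satisfy $3\le d\le n-7$. Let $T_{n,d}=\frac{n(n+1)}{2}-d$. Then \[ \#\mathbb U^*_{T_{n,d}}=1+\#\mathbb D_k. \]
   Context: A partition of $N$ into distinct parts is a sequence of positive integers $\lambda_1<\dots<\lambda_t$ summing to $N$ with $t\ge 2$ (the one-part sequence $(N)$ is not counted); $\mathbb D_N$ is the set of these. Missing parts of $\lambda$: elements of $\{1,\dots,\lambda_t\}\setminus\{\lambda_1,\dots,\lambda_t\}$. $\lambda$ is refinable if two distinct missing parts sum to a part of $\lambda$, unrefinable otherwise; $\mathbb U_N$ is the set of unrefinable partitions of $N$. $\mathbb U^*_N$ is the set of $\lambda\in\mathbb U_N$ whose largest part is the maximum of the largest parts over all of $\mathbb U_N$. Standing assumption: $n\ge 11$. -}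

module Defs where

open import Data.Nat using (ℕ; _+_; _*_; _∸_; _≤_; _<_; _⊔_; suc)
open import Data.List using (List; length; foldr)
open import Data.Nat.ListAction using (sum)
open import Data.List.Relation.Unary.All using (All)
open import Data.List.Relation.Unary.Linked using (Linked)
open import Data.List.Relation.Unary.Unique.Propositional using (Unique)
open import Data.List.Membership.Propositional using (_∈_; _∉_)
open import Data.Product using (Σ; _×_; ∃; ∃-syntax)
open import Relation.Binary.PropositionalEquality using (_≡_; _≢_)
open import Relation.Nullary using (¬_)
open import Function.Bundles using (_⇔_)

-- A partition is represented by the list of its parts in increasing order
-- λ₁ < λ₂ < ... < λ_t.
Partition : Set
Partition = List ℕ

largestPart : Partition → ℕ
largestPart = foldr _⊔_ 0

IsDistinctPartition : ℕ → Partition → Set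
IsDistinctPartition N ps =
  Linked _<_ ps × All (λ x → 1 ≤ x) ps × sum ps ≡ N × 2 ≤ length ps

Missing : Partition → ℕ → Set
Missing ps m = 1 ≤ m × m ≤ largestPart ps × m ∉ ps

Refinable : Partition → Set
Refinable ps = ∃[ a ] ∃[ b ] (a ≢ b × Missing ps a × Missing ps b × (a + b) ∈ ps)

Unrefinable : Partition → Set
Unrefinable ps = ¬ Refinable ps

IsUnrefinablePartition : ℕ → Partition → Set
IsUnrefinablePartition N ps = IsDistinctPartition N ps × Unrefinable ps

IsMaximalUnrefinable : ℕ → Partition → Set
IsMaximalUnrefinable N ps =
  IsUnrefinablePartition N ps ×
  (∀ qs → IsUnrefinablePartition N qs → largestPart qs ≤ largestPart ps)

-- The set {x | P x} is finite with exactly m elements: it is enumerated by a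
-- duplicate-free list of length m.
HasSize : (Partition → Set) → ℕ → Set
HasSize P m =
  Σ (List Partition) λ xs → Unique xs × (∀ ps → (ps ∈ xs) ⇔ P ps) × length xs ≡ m

-- T_{n,d} = n(n+1)/2 - d   (n(n+1) is always even)
open import Data.Nat.DivMod using (_/_)
T : ℕ → ℕ → ℕ
T n d = (n * suc n) / 2 ∸ d

{-# OPTIONS --safe #-}
-- Write m = n − 2; then T n d = T′ m k = Σ_{i<m} i + 2m + 2k with 2k ≤ m. Pairing each i with
-- L − i shows that an unrefinable partition with largest part L has sum at least
-- L + Σ_{i<⌈L/2⌉} i, so partitions in 𝕌 of T′ m k have largest part at most 2m. If the largest
-- part is 2m, unrefinability forces i or 2m − i to be a part for 1 ≤ i < m, and the sum leaves
-- an excess of only 2k over the minimum, which forbids both. Such a partition is therefore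
-- determined by B = {b | m + b is a part} and by whether m is a part; comparing sums, either m is a
-- part, B = ∅ and m = 2k, or m is not a part and B sums to k. In the second case unrefinability
-- amounts to m ≠ 2x for x ∈ B, so B ranges over 𝔻_k together with {k} when m ≠ 2k.
module Submission where

open import Defs
open import Data.Nat
open import Data.Nat.Properties
open import Data.Nat.Tactic.RingSolver using (solve-∀)
open import Data.Nat.ListAction using (sum)
open import Data.Nat.DivMod using (_/_; m*n/n≡m)
open import Algebra.Properties.CommutativeSemigroup +-commutativeSemigroup using (interchange; x∙yz≈y∙xz; x∙yz≈xz∙y; xy∙z≈xz∙y; xy∙z≈y∙xz)
open import Data.Product using (Σ; _×_; _,_; proj₁; proj₂; ∃)
open import Data.Sum using (_⊎_; inj₁; inj₂)
open import Data.Empty using (⊥; ⊥-elim)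
open import Function using (id; _∘_)
open import Function.Bundles using (_⇔_; mk⇔; Equivalence)
open import Relation.Nullary using (¬_; Dec; yes; no)
open import Relation.Nullary.Decidable using (_×-dec_; _⊎-dec_; ¬?)
open import Data.Bool using (Bool; true; false; if_then_else_) renaming (_≟_ to _≟ᵇ_)
open import Relation.Binary.PropositionalEquality
open import Relation.Binary.Definitions using (tri<; tri≈; tri>)
open import Relation.Unary using (Decidable)
open import Data.List using (List; []; _∷_; length; filter; applyUpTo; map; concatMap; upTo; deduplicate)
open import Data.List.Properties using (length-map; ≡-dec)
open import Data.List.Membership.Propositional using (_∈_; _∉_)
open import Data.List.Membership.Propositional.Properties
  using (∈-filter⁺; ∈-filter⁻; ∈-applyUpTo⁺; ∈-applyUpTo⁻; ∈-map⁺; ∈-map⁻; ∈-concatMap⁺; ∈-upTo⁺; ∈-deduplicate⁺; ∈-deduplicate⁻)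
open import Data.List.Membership.DecPropositional _≟_ using (_∈?_)
open import Data.List.Relation.Unary.Any as Any using (here; there)
open import Data.List.Relation.Unary.All as All using (All; []; _∷_; all?)
open import Data.List.Relation.Unary.AllPairs as AllPairs using (AllPairs; []; _∷_)
import Data.List.Relation.Unary.AllPairs.Properties as AllPairsₚ
import Data.List.Relation.Unary.Unique.DecPropositional.Properties as Uniqueₚ
open import Data.List.Relation.Unary.Linked as Linked using (Linked; []; [-]; _∷_; linked?)
open import Data.List.Relation.Unary.Linked.Properties as Linkedₚ using (Linked⇒AllPairs)
open import Data.List.Relation.Unary.Unique.Propositional using (Unique)

Σ< : ℕ → (ℕ → ℕ) → ℕ
Σ< zero    f = 0
Σ< (suc n) f = Σ< n f + f n

Σ<-cong : ∀ n {f g : ℕ → ℕ} → (∀ j → j < n → f j ≡ g j) → Σ< n f ≡ Σ< n g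
Σ<-cong zero    e = refl
Σ<-cong (suc n) e = cong₂ _+_ (Σ<-cong n (λ j j<n → e j (m<n⇒m<1+n j<n))) (e n ≤-refl)

Σ<-mono-≤ : ∀ n {f g : ℕ → ℕ} → (∀ j → j < n → f j ≤ g j) → Σ< n f ≤ Σ< n g
Σ<-mono-≤ zero    e = z≤n
Σ<-mono-≤ (suc n) e = +-mono-≤ (Σ<-mono-≤ n (λ j j<n → e j (m<n⇒m<1+n j<n))) (e n ≤-refl)

Σ<-+ : ∀ n (f g : ℕ → ℕ) → Σ< n (λ j → f j + g j) ≡ Σ< n f + Σ< n g
Σ<-+ zero    f g = refl
Σ<-+ (suc n) f g = begin
  Σ< n (λ j → f j + g j) + (f n + g n) ≡⟨ cong (_+ (f n + g n)) (Σ<-+ n f g) ⟩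
  Σ< n f + Σ< n g + (f n + g n)        ≡⟨ interchange (Σ< n f) (Σ< n g) (f n) (g n) ⟩
  Σ< n f + f n + (Σ< n g + g n)        ∎
  where open ≡-Reasoning

Σ<-suc : ∀ n (f : ℕ → ℕ) → Σ< (suc n) f ≡ f 0 + Σ< n (f ∘ suc)
Σ<-suc zero    f = +-comm 0 (f 0)
Σ<-suc (suc n) f = trans (cong (_+ f (suc n)) (Σ<-suc n f)) (+-assoc (f 0) _ _)

Σ<-split : ∀ a b (f : ℕ → ℕ) → Σ< (a + b) f ≡ Σ< a f + Σ< b (λ j → f (a + j))
Σ<-split a zero    f = trans (cong (λ c → Σ< c f) (+-identityʳ a)) (sym (+-identityʳ _))
Σ<-split a (suc b) f rewrite +-suc a b | Σ<-split a b f = +-assoc (Σ< a f) _ _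

Σ<-reverse : ∀ n (f : ℕ → ℕ) → Σ< n f ≡ Σ< n (λ j → f (n ∸ suc j))
Σ<-reverse zero    f = refl
Σ<-reverse (suc n) f = begin
  Σ< n f + f n                         ≡⟨ cong (_+ f n) (Σ<-reverse n f) ⟩
  Σ< n (λ j → f (n ∸ suc j)) + f n     ≡⟨ +-comm _ (f n) ⟩
  f n + Σ< n (λ j → f (n ∸ suc j))     ≡⟨ sym (Σ<-suc n (λ j → f (suc n ∸ suc j))) ⟩
  Σ< (suc n) (λ j → f (suc n ∸ suc j)) ∎
  where open ≡-Reasoning

Σ<-monoˡ-≤ : ∀ (f : ℕ → ℕ) {a b} → a ≤ b → Σ< a f ≤ Σ< b f
Σ<-monoˡ-≤ f {a} a≤b with o , refl ← m≤n⇒∃[o]m+o≡n a≤b =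
  ≤-trans (m≤m+n _ _) (≤-reflexive (sym (Σ<-split a o f)))

Σ<-≡0 : ∀ n (f : ℕ → ℕ) → (∀ j → j < n → f j ≡ 0) → Σ< n f ≡ 0
Σ<-≡0 n f e = trans (Σ<-cong n e) (Σ<-zero n)
  where
  Σ<-zero : ∀ n → Σ< n (λ _ → 0) ≡ 0
  Σ<-zero zero    = refl
  Σ<-zero (suc n) = trans (+-identityʳ _) (Σ<-zero n)

Σ<-mono-≤-+ : ∀ n {f g : ℕ → ℕ} {x d} → (∀ j → j < n → g j ≤ f j) → x < n → g x + d ≤ f x →
              Σ< n g + d ≤ Σ< n f
Σ<-mono-≤-+ (suc n) {f} {g} {x} {d} g≤f x<1+n gx+d≤fx with x ≟ n
... | yes refl = begin
  Σ< n g + g x + d   ≡⟨ +-assoc (Σ< n g) (g x) d ⟩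
  Σ< n g + (g x + d) ≤⟨ +-mono-≤ (Σ<-mono-≤ n (λ j j<n → g≤f j (m<n⇒m<1+n j<n))) gx+d≤fx ⟩
  Σ< n f + f x       ∎
  where open ≤-Reasoning
... | no x≢n = begin
  Σ< n g + g n + d   ≡⟨ xy∙z≈xz∙y (Σ< n g) (g n) d ⟩
  Σ< n g + d + g n   ≤⟨ +-mono-≤ (Σ<-mono-≤-+ n (λ j j<n → g≤f j (m<n⇒m<1+n j<n)) (≤∧≢⇒< (≤-pred x<1+n) x≢n) gx+d≤fx)
                                 (g≤f n ≤-refl) ⟩
  Σ< n f + f n       ∎
  where open ≤-Reasoning

pointMass : ℕ → ℕ → ℕ → ℕ
pointMass x c j with j ≟ x
... | yes _ = c
... | no  _ = 0

pointMass-at : ∀ x c → pointMass x c x ≡ c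
pointMass-at x c with x ≟ x
... | yes _   = refl
... | no x≢x = ⊥-elim (x≢x refl)

pointMass-off : ∀ x c {j} → j ≢ x → pointMass x c j ≡ 0
pointMass-off x c {j} j≢x with j ≟ x
... | yes j≡x = ⊥-elim (j≢x j≡x)
... | no  _   = refl

Σ<-pointMass : ∀ n x c → x < n → Σ< n (pointMass x c) ≡ c
Σ<-pointMass (suc n) x c x<1+n with x ≟ n
... | yes refl = begin
  Σ< n (pointMass x c) + pointMass x c x ≡⟨ cong₂ _+_ Σ<-before (pointMass-at x c) ⟩
  0 + c                                 ∎
  where
  open ≡-Reasoning
  Σ<-before : Σ< n (pointMass x c) ≡ 0
  Σ<-before = Σ<-≡0 n _ (λ j j<x → pointMass-off x c (<⇒≢ j<x))
... | no x≢n = begin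
  Σ< n (pointMass x c) + pointMass x c n ≡⟨ cong₂ _+_ (Σ<-pointMass n x c (≤∧≢⇒< (≤-pred x<1+n) x≢n))
                                                     (pointMass-off x c (x≢n ∘ sym)) ⟩
  c + 0                                 ≡⟨ +-identityʳ c ⟩
  c                                     ∎
  where open ≡-Reasoning

Σ<-id-*2 : ∀ n → Σ< (suc n) id * 2 ≡ n * suc n
Σ<-id-*2 zero    = refl
Σ<-id-*2 (suc n) = begin
  (Σ< (suc n) id + suc n) * 2 ≡⟨ *-distribʳ-+ 2 (Σ< (suc n) id) (suc n) ⟩
  Σ< (suc n) id * 2 + suc n * 2 ≡⟨ cong (_+ suc n * 2) (Σ<-id-*2 n) ⟩
  n * suc n + suc n * 2       ≡⟨ shift n ⟩
  suc n * suc (suc n)         ∎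
  where
  open ≡-Reasoning
  shift : ∀ n → n * suc n + suc n * 2 ≡ suc n * suc (suc n)
  shift = solve-∀

Σ<-fold-even : ∀ m (f : ℕ → ℕ) →
               Σ< (suc (m + m)) f ≡ f m + Σ< m (λ i → f i + f (m + m ∸ i))
Σ<-fold-even m f = begin
  Σ< (suc (m + m)) f                                  ≡⟨ cong (λ c → Σ< c f) (sym (+-suc m m)) ⟩
  Σ< (m + suc m) f                                    ≡⟨ Σ<-split m (suc m) f ⟩
  Σ< m f + Σ< (suc m) (λ j → f (m + j))               ≡⟨ cong (Σ< m f +_) (Σ<-suc m (λ j → f (m + j))) ⟩
  Σ< m f + (f (m + 0) + Σ< m (λ j → f (m + suc j)))   ≡⟨ cong (λ z → Σ< m f + (f z + Σ< m (λ j → f (m + suc j)))) (+-identityʳ m) ⟩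
  Σ< m f + (f m + Σ< m (λ j → f (m + suc j)))         ≡⟨ cong (λ z → Σ< m f + (f m + z)) upper ⟩
  Σ< m f + (f m + Σ< m (λ i → f (m + m ∸ i)))         ≡⟨ x∙yz≈y∙xz (Σ< m f) (f m) _ ⟩
  f m + (Σ< m f + Σ< m (λ i → f (m + m ∸ i)))         ≡⟨ cong (f m +_) (sym (Σ<-+ m f _)) ⟩
  f m + Σ< m (λ i → f i + f (m + m ∸ i))              ∎
  where
  open ≡-Reasoning
  upper : Σ< m (λ j → f (m + suc j)) ≡ Σ< m (λ i → f (m + m ∸ i))
  upper = trans (Σ<-reverse m _) (Σ<-cong m λ i i<m → cong f (begin
    m + suc (m ∸ suc i) ≡⟨ cong (m +_) (sym (+-∸-assoc 1 i<m)) ⟩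
    m + (m ∸ i)         ≡⟨ sym (+-∸-assoc m (<⇒≤ i<m)) ⟩
    m + m ∸ i           ∎))

Σ<-fold-odd : ∀ m (f : ℕ → ℕ) →
              Σ< (suc m + suc m) f ≡ Σ< (suc m) (λ i → f i + f (suc (m + m) ∸ i))
Σ<-fold-odd m f = begin
  Σ< (suc m + suc m) f                                     ≡⟨ Σ<-split (suc m) (suc m) f ⟩
  Σ< (suc m) f + Σ< (suc m) (λ j → f (suc m + j))          ≡⟨ cong (Σ< (suc m) f +_) upper ⟩
  Σ< (suc m) f + Σ< (suc m) (λ i → f (suc (m + m) ∸ i))    ≡⟨ sym (Σ<-+ (suc m) f _) ⟩
  Σ< (suc m) (λ i → f i + f (suc (m + m) ∸ i))             ∎
  where
  open ≡-Reasoning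
  upper : Σ< (suc m) (λ j → f (suc m + j)) ≡ Σ< (suc m) (λ i → f (suc (m + m) ∸ i))
  upper = trans (Σ<-reverse (suc m) _)
                (Σ<-cong (suc m) λ i i<1+m → cong f (sym (+-∸-assoc (suc m) (≤-pred i<1+m))))

partAt : List ℕ → ℕ → ℕ
partAt xs j with j ∈? xs
... | yes _ = j
... | no  _ = 0

partAt-∈ : ∀ {xs j} → j ∈ xs → partAt xs j ≡ j
partAt-∈ {xs} {j} j∈xs with j ∈? xs
... | yes _   = refl
... | no  j∉xs = ⊥-elim (j∉xs j∈xs)

partAt-∉ : ∀ {xs j} → j ∉ xs → partAt xs j ≡ 0
partAt-∉ {xs} {j} j∉xs with j ∈? xs
... | yes j∈xs = ⊥-elim (j∉xs j∈xs)
... | no  _    = refl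

partAt-≤ : ∀ xs j → partAt xs j ≤ j
partAt-≤ xs j with j ∈? xs
... | yes _ = ≤-refl
... | no  _ = z≤n

sum≡Σ<partAt : ∀ n xs → Unique xs → All (_< n) xs → sum xs ≡ Σ< n (partAt xs)
sum≡Σ<partAt n []       _           _          = sym (Σ<-≡0 n _ (λ j _ → partAt-∉ {[]} {j} λ ()))
sum≡Σ<partAt n (x ∷ xs) (x∉ ∷ uniq) (x<n ∷ xs<n) = begin
  x + sum xs                                       ≡⟨ cong₂ _+_ (sym (Σ<-pointMass n x x x<n)) (sum≡Σ<partAt n xs uniq xs<n) ⟩
  Σ< n (pointMass x x) + Σ< n (partAt xs)          ≡⟨ sym (Σ<-+ n (pointMass x x) (partAt xs)) ⟩
  Σ< n (λ j → pointMass x x j + partAt xs j)       ≡⟨ Σ<-cong n (λ j _ → split j) ⟩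
  Σ< n (partAt (x ∷ xs))                           ∎
  where
  open ≡-Reasoning
  x∉xs : x ∉ xs
  x∉xs x∈xs = All.lookup x∉ x∈xs refl
  split : ∀ j → pointMass x x j + partAt xs j ≡ partAt (x ∷ xs) j
  split j = by-cases (j ≟ x) (j ∈? xs)
    where
    by-cases : Dec (j ≡ x) → Dec (j ∈ xs) → pointMass x x j + partAt xs j ≡ partAt (x ∷ xs) j
    by-cases (yes refl) _ = begin
      pointMass x x x + partAt xs x ≡⟨ cong₂ _+_ (pointMass-at x x) (partAt-∉ x∉xs) ⟩
      x + 0                         ≡⟨ +-identityʳ x ⟩
      x                             ≡⟨ sym (partAt-∈ (here refl)) ⟩
      partAt (x ∷ xs) x             ∎
    by-cases (no j≢x) (yes j∈xs) =
      trans (cong₂ _+_ (pointMass-off x x j≢x) (partAt-∈ j∈xs)) (sym (partAt-∈ (there j∈xs)))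
    by-cases (no j≢x) (no j∉xs) =
      trans (cong₂ _+_ (pointMass-off x x j≢x) (partAt-∉ j∉xs))
            (sym (partAt-∉ {x ∷ xs} {j} λ { (here j≡x) → j≢x j≡x ; (there j∈xs) → j∉xs j∈xs }))

Σ<-partAt-reverse : ∀ m xs → Unique xs → All (_< m) xs → Σ< m (λ i → partAt xs (m ∸ i)) ≡ sum xs
Σ<-partAt-reverse m xs uniq xs<m = begin
  Σ< m (λ i → partAt xs (m ∸ i))            ≡⟨ Σ<-reverse m _ ⟩
  Σ< m (λ j → partAt xs (m ∸ (m ∸ suc j)))  ≡⟨ Σ<-cong m (λ j j<m → cong (partAt xs) (m∸[m∸n]≡n j<m)) ⟩
  Σ< m (partAt xs ∘ suc)                     ≡⟨ cong (_+ Σ< m (partAt xs ∘ suc)) (sym (n≤0⇒n≡0 (partAt-≤ xs 0))) ⟩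
  partAt xs 0 + Σ< m (partAt xs ∘ suc)       ≡⟨ sym (Σ<-suc m (partAt xs)) ⟩
  Σ< (suc m) (partAt xs)                     ≡⟨ sym (sum≡Σ<partAt (suc m) xs uniq (All.map m<n⇒m<1+n xs<m)) ⟩
  sum xs                                     ∎
  where open ≡-Reasoning

Linked<⇒Unique : ∀ {xs} → Linked _<_ xs → Unique xs
Linked<⇒Unique increasing = AllPairs.map <⇒≢ (Linked⇒AllPairs <-trans increasing)

head<∈tail : ∀ {x xs j} → Linked _<_ (x ∷ xs) → j ∈ xs → x < j
head<∈tail (x<y ∷ _)          (here refl) = x<y
head<∈tail (x<y ∷ increasing) (there j∈)  = <-trans x<y (head<∈tail increasing j∈)

Linked<-ext : ∀ {xs ys} → Linked _<_ xs → Linked _<_ ys →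
              (∀ {j} → j ∈ xs → j ∈ ys) → (∀ {j} → j ∈ ys → j ∈ xs) → xs ≡ ys
Linked<-ext {[]}     {[]}     _  _  _  _  = refl
Linked<-ext {[]}     {y ∷ ys} _  _  _  ⊇ with () ← ⊇ (here refl)
Linked<-ext {x ∷ xs} {[]}     _  _  ⊆  _  with () ← ⊆ (here refl)
Linked<-ext {x ∷ xs} {y ∷ ys} lx ly ⊆ ⊇ =
  cong₂ _∷_ x≡y (Linked<-ext (Linked.tail lx) (Linked.tail ly) ⊆-tail ⊇-tail)
  where
  x≡y : x ≡ y
  x≡y with ⊆ (here refl) | ⊇ (here refl)
  ... | here x≡y | _         = x≡y
  ... | there _  | here y≡x  = sym y≡x
  ... | there x∈ | there y∈  = ⊥-elim (<-asym (head<∈tail ly x∈) (head<∈tail lx y∈))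
  ⊆-tail : ∀ {j} → j ∈ xs → j ∈ ys
  ⊆-tail j∈ with ⊆ (there j∈)
  ... | here refl = ⊥-elim (<-irrefl x≡y (head<∈tail lx j∈))
  ... | there j∈′ = j∈′
  ⊇-tail : ∀ {j} → j ∈ ys → j ∈ xs
  ⊇-tail j∈ with ⊇ (there j∈)
  ... | here refl = ⊥-elim (<-irrefl (sym x≡y) (head<∈tail ly j∈))
  ... | there j∈′ = j∈′

∈⇒≤largestPart : ∀ {x xs} → x ∈ xs → x ≤ largestPart xs
∈⇒≤largestPart {x} {.x ∷ xs} (here refl) = m≤m⊔n x _
∈⇒≤largestPart {x} {y ∷ xs}  (there x∈)  = ≤-trans (∈⇒≤largestPart x∈) (m≤n⊔m y _)

largestPart-∈ : ∀ x xs → largestPart (x ∷ xs) ∈ x ∷ xs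
largestPart-∈ x []       = subst (_∈ x ∷ []) (sym (⊔-identityʳ x)) (here refl)
largestPart-∈ x (y ∷ xs) with ⊔-sel x (largestPart (y ∷ xs))
... | inj₁ ⊔≡x = subst (_∈ x ∷ y ∷ xs) (sym ⊔≡x) (here refl)
... | inj₂ ⊔≡l = subst (_∈ x ∷ y ∷ xs) (sym ⊔≡l) (there (largestPart-∈ y xs))

largestPart-unique : ∀ {L xs} → L ∈ xs → (∀ {x} → x ∈ xs → x ≤ L) → largestPart xs ≡ L
largestPart-unique {L} {xs} L∈xs ≤L = ≤-antisym (bound xs ≤L) (∈⇒≤largestPart L∈xs)
  where
  bound : ∀ xs → (∀ {x} → x ∈ xs → x ≤ L) → largestPart xs ≤ L
  bound []       _   = z≤n
  bound (x ∷ xs) ≤L′ = ⊔-lub (≤L′ (here refl)) (bound xs (≤L′ ∘ there))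

∈⇒≤sum : ∀ {x xs} → x ∈ xs → x ≤ sum xs
∈⇒≤sum {x} {.x ∷ xs} (here refl) = m≤m+n x _
∈⇒≤sum {x} {y ∷ xs}  (there x∈)  = ≤-trans (∈⇒≤sum x∈) (m≤n+m _ y)

∈₂⇒+≤sum : ∀ {x y xs} → x ∈ xs → y ∈ xs → x ≢ y → x + y ≤ sum xs
∈₂⇒+≤sum (here refl) (here refl) x≢y = ⊥-elim (x≢y refl)
∈₂⇒+≤sum (here refl) (there y∈)  _   = +-monoʳ-≤ _ (∈⇒≤sum y∈)
∈₂⇒+≤sum {x} {y} {z ∷ zs} (there x∈) (here refl) _ =
  subst (_≤ z + sum zs) (+-comm y x) (+-monoʳ-≤ z (∈⇒≤sum x∈))
∈₂⇒+≤sum {xs = z ∷ _} (there x∈) (there y∈) x≢y = ≤-trans (∈₂⇒+≤sum x∈ y∈ x≢y) (m≤n+m _ z)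

∈₃⇒+≤sum : ∀ {x y z xs} → x ∈ xs → y ∈ xs → z ∈ xs → x ≢ y → x ≢ z → y ≢ z → x + y + z ≤ sum xs
∈₃⇒+≤sum (here refl) (here refl) _ x≢y _ _ = ⊥-elim (x≢y refl)
∈₃⇒+≤sum (here refl) _ (here refl) _ x≢z _ = ⊥-elim (x≢z refl)
∈₃⇒+≤sum _ (here refl) (here refl) _ _ y≢z = ⊥-elim (y≢z refl)
∈₃⇒+≤sum {x} (here refl) (there y∈) (there z∈) _ _ y≢z =
  ≤-trans (≤-reflexive (+-assoc x _ _)) (+-monoʳ-≤ x (∈₂⇒+≤sum y∈ z∈ y≢z))
∈₃⇒+≤sum {x} {y} {z} {.y ∷ ws} (there x∈) (here refl) (there z∈) _ x≢z _ = begin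
  x + y + z   ≡⟨ cong (_+ z) (+-comm x y) ⟩
  y + x + z   ≡⟨ +-assoc y x z ⟩
  y + (x + z) ≤⟨ +-monoʳ-≤ y (∈₂⇒+≤sum x∈ z∈ x≢z) ⟩
  y + sum ws  ∎
  where open ≤-Reasoning
∈₃⇒+≤sum {x} {y} {z} {.z ∷ ws} (there x∈) (there y∈) (here refl) x≢y _ _ =
  subst (_≤ z + sum ws) (+-comm z (x + y)) (+-monoʳ-≤ z (∈₂⇒+≤sum x∈ y∈ x≢y))
∈₃⇒+≤sum {xs = w ∷ _} (there x∈) (there y∈) (there z∈) x≢y x≢z y≢z =
  ≤-trans (∈₃⇒+≤sum x∈ y∈ z∈ x≢y x≢z y≢z) (m≤n+m _ w)

positive-sum≡0⇒[] : ∀ xs → All (1 ≤_) xs → sum xs ≡ 0 → xs ≡ []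
positive-sum≡0⇒[] []       _          _   = refl
positive-sum≡0⇒[] (x ∷ xs) (1≤x ∷ _) sum≡0 = ⊥-elim (<⇒≢ 1≤x (sym (m+n≡0⇒m≡0 x sum≡0)))

∈-other : ∀ {xs} {x : ℕ} → Unique xs → 2 ≤ length xs → x ∈ xs → ∃ λ y → y ∈ xs × x ≢ y
∈-other {y₁ ∷ y₂ ∷ _} {x} ((y₁≢y₂ ∷ _) ∷ _) _ _ with x ≟ y₁
... | yes refl = y₂ , there (here refl) , y₁≢y₂
... | no x≢y₁  = y₁ , here refl , x≢y₁
∈-other {_ ∷ []} _ (s≤s ()) _

largestPart<sum⇒2≤length : ∀ xs → largestPart xs < sum xs → 2 ≤ length xs
largestPart<sum⇒2≤length []          ()
largestPart<sum⇒2≤length (x ∷ [])    x⊔0<x+0 =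
  ⊥-elim (<-irrefl (trans (⊔-identityʳ x) (sym (+-identityʳ x))) x⊔0<x+0)
largestPart<sum⇒2≤length (_ ∷ _ ∷ _) _ = s≤s (s≤s z≤n)

length≤sum : ∀ {xs} → All (1 ≤_) xs → length xs ≤ sum xs
length≤sum []          = z≤n
length≤sum (1≤x ∷ 1≤xs) = +-mono-≤ 1≤x (length≤sum 1≤xs)

module Interval (top : ℕ) {P : ℕ → Set} (P? : Decidable P) where

  list : List ℕ
  list = filter P? (applyUpTo suc top)

  list-increasing : Linked _<_ list
  list-increasing = Linkedₚ.filter⁺ P? <-trans (Linkedₚ.applyUpTo⁺₂ suc top (λ _ → ≤-refl))

  ∈-list⁻ : ∀ {j} → j ∈ list → 1 ≤ j × j ≤ top × P j
  ∈-list⁻ j∈ with ∈-filter⁻ P? {xs = applyUpTo suc top} j∈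
  ... | j∈range , Pj with i , i<top , refl ← ∈-applyUpTo⁻ suc {n = top} j∈range = s≤s z≤n , i<top , Pj

  ∈-list⁺ : ∀ {j} → 1 ≤ j → j ≤ top → P j → j ∈ list
  ∈-list⁺ {suc i} _ i<top Pj = ∈-filter⁺ P? {xs = applyUpTo suc top} (∈-applyUpTo⁺ suc i<top) Pj

  list-positive : All (1 ≤_) list
  list-positive = All.tabulate (proj₁ ∘ ∈-list⁻)

-- A lower bound for the sum of an unrefinable partition

largestPart∈ : ∀ {N ps} → IsDistinctPartition N ps → largestPart ps ∈ ps
largestPart∈ {ps = x ∷ xs} _ = largestPart-∈ x xs

sum≡Σ<partAt-largestPart : ∀ {N ps} → IsDistinctPartition N ps →
                           sum ps ≡ Σ< (suc (largestPart ps)) (partAt ps)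
sum≡Σ<partAt-largestPart {ps = ps} (increasing , _) =
  sum≡Σ<partAt _ ps (Linked<⇒Unique increasing) (All.tabulate (s≤s ∘ ∈⇒≤largestPart))

∈⊎complement∈ : ∀ {ps c i} → Unrefinable ps → c ∈ ps → 1 ≤ i → i < c ∸ i → i ∈ ps ⊎ c ∸ i ∈ ps
∈⊎complement∈ {ps} {c} {i} unrefinable c∈ps 1≤i i<c∸i with i ∈? ps | c ∸ i ∈? ps
... | yes i∈ | _       = inj₁ i∈
... | no _   | yes j∈  = inj₂ j∈
... | no i∉  | no j∉   = ⊥-elim (unrefinable (i , c ∸ i , <⇒≢ i<c∸i ,
      (1≤i , ≤-trans i≤c c≤L , i∉) , (≤-trans 1≤i (<⇒≤ i<c∸i) , ≤-trans (m∸n≤m c i) c≤L , j∉) ,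
      subst (_∈ ps) (sym (m+[n∸m]≡n i≤c)) c∈ps))
  where
  c≤L : c ≤ largestPart ps
  c≤L = ∈⇒≤largestPart c∈ps
  i≤c : i ≤ c
  i≤c = ≤-trans (<⇒≤ i<c∸i) (m∸n≤m c i)

partAt-pair-≥ : ∀ {ps c} → Unrefinable ps → c ∈ ps → ∀ i → i + i < c →
         i + pointMass 0 c i ≤ partAt ps i + partAt ps (c ∸ i)
partAt-pair-≥ {ps} {c} _ c∈ps zero _ = begin
  pointMass 0 c 0             ≡⟨ pointMass-at 0 c ⟩
  c                           ≡⟨ sym (partAt-∈ c∈ps) ⟩
  partAt ps c                 ≤⟨ m≤n+m _ _ ⟩
  partAt ps 0 + partAt ps c   ∎
  where open ≤-Reasoning
partAt-pair-≥ {ps} {c} unrefinable c∈ps i@(suc _) 2i<c = begin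
  i + pointMass 0 c i                 ≡⟨ cong (i +_) (pointMass-off 0 c {i} (λ ())) ⟩
  i + 0                               ≡⟨ +-identityʳ i ⟩
  i                                   ≤⟨ one-of (∈⊎complement∈ unrefinable c∈ps (s≤s z≤n) i<c∸i) ⟩
  partAt ps i + partAt ps (c ∸ i)     ∎
  where
  open ≤-Reasoning
  i<c∸i : i < c ∸ i
  i<c∸i = subst (_< c ∸ i) (m+n∸n≡m i i) (∸-monoˡ-< 2i<c (m≤n+m i i))
  one-of : i ∈ ps ⊎ c ∸ i ∈ ps → i ≤ partAt ps i + partAt ps (c ∸ i)
  one-of (inj₁ i∈) = ≤-trans (≤-reflexive (sym (partAt-∈ i∈))) (m≤m+n _ _)
  one-of (inj₂ j∈) = ≤-trans (<⇒≤ i<c∸i) (≤-trans (≤-reflexive (sym (partAt-∈ j∈))) (m≤n+m _ _))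

Σ<-pairs-≥ : ∀ {ps c} → Unrefinable ps → c ∈ ps → ∀ h → 1 ≤ h → (∀ i → i < h → i + i < c) →
             c + Σ< h id ≤ Σ< h (λ i → partAt ps i + partAt ps (c ∸ i))
Σ<-pairs-≥ {ps} {c} unrefinable c∈ps h 1≤h 2i<c = begin
  c + Σ< h id                                ≡⟨ +-comm c _ ⟩
  Σ< h id + c                                ≡⟨ cong (Σ< h id +_) (sym (Σ<-pointMass h 0 c 1≤h)) ⟩
  Σ< h id + Σ< h (pointMass 0 c)             ≡⟨ sym (Σ<-+ h id (pointMass 0 c)) ⟩
  Σ< h (λ i → i + pointMass 0 c i)           ≤⟨ Σ<-mono-≤ h (λ i i<h → partAt-pair-≥ unrefinable c∈ps i (2i<c i i<h)) ⟩
  Σ< h (λ i → partAt ps i + partAt ps (c ∸ i)) ∎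
  where open ≤-Reasoning

even⊎odd : ∀ n → ∃ λ h → n ≡ h + h ⊎ n ≡ suc (h + h)
even⊎odd zero = 0 , inj₁ refl
even⊎odd (suc n) with even⊎odd n
... | h , inj₁ n≡2h   = h , inj₂ (cong suc n≡2h)
... | h , inj₂ n≡2h+1 = suc h , inj₁ (trans (cong suc n≡2h+1) (sym (+-suc (suc h) h)))

unrefinable-part-≥ : ∀ {ps} c → Unrefinable ps → c ∈ ps → c + Σ< ⌈ c /2⌉ id ≤ Σ< (suc c) (partAt ps)
unrefinable-part-≥ {ps} c unrefinable c∈ps with even⊎odd c
... | zero , inj₁ refl = z≤n
... | h@(suc _) , inj₁ refl = begin
  h + h + Σ< ⌈ h + h /2⌉ id                        ≡⟨ cong (λ t → h + h + Σ< t id) (sym (n≡⌈n+n/2⌉ h)) ⟩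
  h + h + Σ< h id                                  ≤⟨ Σ<-pairs-≥ unrefinable c∈ps h (s≤s z≤n) (λ i i<h → +-mono-< i<h i<h) ⟩
  Σ< h (λ i → partAt ps i + partAt ps (h + h ∸ i)) ≤⟨ m≤n+m _ (partAt ps h) ⟩
  partAt ps h + Σ< h (λ i → partAt ps i + partAt ps (h + h ∸ i)) ≡⟨ sym (Σ<-fold-even h (partAt ps)) ⟩
  Σ< (suc (h + h)) (partAt ps)                     ∎
  where open ≤-Reasoning
... | h , inj₂ refl = begin
  suc (h + h) + Σ< (suc ⌊ h + h /2⌋) id            ≡⟨ cong (λ t → suc (h + h) + Σ< (suc t) id) (sym (n≡⌊n+n/2⌋ h)) ⟩
  suc (h + h) + Σ< (suc h) id                      ≤⟨ Σ<-pairs-≥ unrefinable c∈ps (suc h) (s≤s z≤n) 2i<c ⟩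
  Σ< (suc h) (λ i → partAt ps i + partAt ps (suc (h + h) ∸ i)) ≡⟨ sym (Σ<-fold-odd h (partAt ps)) ⟩
  Σ< (suc h + suc h) (partAt ps)                   ≡⟨ cong (λ t → Σ< (suc t) (partAt ps)) (+-suc h h) ⟩
  Σ< (suc (suc (h + h))) (partAt ps)               ∎
  where
  open ≤-Reasoning
  2i<c : ∀ i → i < suc h → i + i < suc (h + h)
  2i<c i i<1+h = s≤s (+-mono-≤ (≤-pred i<1+h) (≤-pred i<1+h))

unrefinable-sum-≥ : ∀ {N ps} → IsUnrefinablePartition N ps → largestPart ps + Σ< ⌈ largestPart ps /2⌉ id ≤ N
unrefinable-sum-≥ (distinct@(_ , _ , sum≡N , _) , unrefinable) =
  ≤-trans (unrefinable-part-≥ _ unrefinable (largestPart∈ distinct))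
          (≤-reflexive (trans (sym (sum≡Σ<partAt-largestPart distinct)) sum≡N))

-- The partitions Φ m B mid

IsΦPart : ℕ → List ℕ → Bool → ℕ → Set
IsΦPart m B mid j = (j < m × m ∸ j ∉ B) ⊎ (j ≡ m × mid ≡ true) ⊎ ((m < j × j < m + m) × j ∸ m ∈ B) ⊎ j ≡ m + m

isΦPart? : ∀ m B mid → Decidable (IsΦPart m B mid)
isΦPart? m B mid j =
  (j <? m ×-dec ¬? (m ∸ j ∈? B)) ⊎-dec (j ≟ m ×-dec mid ≟ᵇ true) ⊎-dec
  ((m <? j ×-dec j <? m + m) ×-dec (j ∸ m ∈? B)) ⊎-dec (j ≟ m + m)

Φ : ℕ → List ℕ → Bool → List ℕ
Φ m B mid = Interval.list (m + m) (isΦPart? m B mid)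

module ΦProperties (m : ℕ) (B : List ℕ) (mid : Bool) where
  open Interval (m + m) (isΦPart? m B mid)

  Φ-increasing : Linked _<_ (Φ m B mid)
  Φ-increasing = list-increasing

  Φ-positive : All (1 ≤_) (Φ m B mid)
  Φ-positive = list-positive

  Φ-≤top : ∀ {j} → j ∈ Φ m B mid → j ≤ m + m
  Φ-≤top = proj₁ ∘ proj₂ ∘ ∈-list⁻

  Φ-top : 1 ≤ m → m + m ∈ Φ m B mid
  Φ-top 1≤m = ∈-list⁺ (≤-trans 1≤m (m≤m+n m m)) ≤-refl (inj₂ (inj₂ (inj₂ refl)))

  Φ-lower⁺ : ∀ {i} → 1 ≤ i → i < m → m ∸ i ∉ B → i ∈ Φ m B mid
  Φ-lower⁺ 1≤i i<m m∸i∉ = ∈-list⁺ 1≤i (≤-trans (<⇒≤ i<m) (m≤m+n m m)) (inj₁ (i<m , m∸i∉))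

  Φ-lower⁻ : ∀ {i} → i < m → i ∈ Φ m B mid → m ∸ i ∉ B
  Φ-lower⁻ i<m i∈ with proj₂ (proj₂ (∈-list⁻ i∈))
  ... | inj₁ (_ , m∸i∉)                  = m∸i∉
  ... | inj₂ (inj₁ (refl , _))           = ⊥-elim (<-irrefl refl i<m)
  ... | inj₂ (inj₂ (inj₁ ((m<i , _) , _))) = ⊥-elim (<-asym i<m m<i)
  ... | inj₂ (inj₂ (inj₂ refl))          = ⊥-elim (<-irrefl refl (≤-trans i<m (m≤m+n m m)))

  Φ-upper⁺ : ∀ {b} → 1 ≤ b → b < m → b ∈ B → m + b ∈ Φ m B mid
  Φ-upper⁺ {b} 1≤b b<m b∈ = ∈-list⁺ (≤-trans 1≤b (m≤n+m b m)) (+-monoʳ-≤ m (<⇒≤ b<m))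
    (inj₂ (inj₂ (inj₁ ((m<m+b , +-monoʳ-< m b<m) , subst (_∈ B) (sym (m+n∸m≡n m b)) b∈))))
    where
    m<m+b : m < m + b
    m<m+b = subst (_≤ m + b) (+-comm m 1) (+-monoʳ-≤ m 1≤b)

  Φ-upper⁻ : ∀ {b} → 1 ≤ b → b < m → m + b ∈ Φ m B mid → b ∈ B
  Φ-upper⁻ {b} 1≤b b<m j∈ with proj₂ (proj₂ (∈-list⁻ j∈))
  ... | inj₁ (m+b<m , _)         = ⊥-elim (<-irrefl refl (≤-trans m+b<m (m≤m+n m b)))
  ... | inj₂ (inj₁ (m+b≡m , _))  = ⊥-elim (<-irrefl (sym (+-cancelˡ-≡ m b 0 (trans m+b≡m (sym (+-identityʳ m))))) 1≤b)
  ... | inj₂ (inj₂ (inj₁ (_ , b∈))) = subst (_∈ B) (m+n∸m≡n m b) b∈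
  ... | inj₂ (inj₂ (inj₂ m+b≡m+m)) = ⊥-elim (<-irrefl (+-cancelˡ-≡ m b m m+b≡m+m) b<m)

  Φ-part⁻ : ∀ {j} → j ∈ Φ m B mid → IsΦPart m B mid j
  Φ-part⁻ = proj₂ ∘ proj₂ ∘ ∈-list⁻

  Φ-mid⁺ : 1 ≤ m → mid ≡ true → m ∈ Φ m B mid
  Φ-mid⁺ 1≤m mid≡true = ∈-list⁺ 1≤m (m≤m+n m m) (inj₂ (inj₁ (refl , mid≡true)))

  Φ-mid⁻ : 1 ≤ m → m ∈ Φ m B mid → mid ≡ true
  Φ-mid⁻ 1≤m m∈ with proj₂ (proj₂ (∈-list⁻ m∈))
  ... | inj₁ (m<m , _)               = ⊥-elim (<-irrefl refl m<m)
  ... | inj₂ (inj₁ (_ , mid≡true))   = mid≡true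
  ... | inj₂ (inj₂ (inj₁ ((m<m , _) , _))) = ⊥-elim (<-irrefl refl m<m)
  ... | inj₂ (inj₂ (inj₂ m≡m+m))     = ⊥-elim (<-irrefl (sym (+-cancelˡ-≡ m m 0 (trans (sym m≡m+m) (sym (+-identityʳ m))))) 1≤m)

  Φ-pair-zero : 1 ≤ m → All (_< m) B →
                partAt (Φ m B mid) 0 + partAt (Φ m B mid) (m + m) ≡ pointMass 0 (m + m) 0 + (partAt B m + partAt B m)
  Φ-pair-zero 1≤m B<m = begin
    partAt (Φ m B mid) 0 + partAt (Φ m B mid) (m + m) ≡⟨ cong₂ _+_ (partAt-∉ (λ 0∈ → 1≰0 (All.lookup Φ-positive 0∈)))
                                                                   (partAt-∈ (Φ-top 1≤m)) ⟩
    m + m                                             ≡⟨ sym (+-identityʳ _) ⟩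
    (m + m) + 0                                       ≡⟨ sym (cong₂ _+_ (pointMass-at 0 (m + m)) (cong₂ _+_ m∉ m∉)) ⟩
    pointMass 0 (m + m) 0 + (partAt B m + partAt B m) ∎
    where
    open ≡-Reasoning
    1≰0 : ¬ 1 ≤ 0
    1≰0 ()
    m∉ : partAt B m ≡ 0
    m∉ = partAt-∉ (λ m∈ → <-irrefl refl (All.lookup B<m m∈))
  Φ-pair-suc : ∀ {i} → 1 ≤ i → i < m →
               partAt (Φ m B mid) i + partAt (Φ m B mid) (m + m ∸ i)
                 ≡ (i + pointMass 0 (m + m) i) + (partAt B (m ∸ i) + partAt B (m ∸ i))
  Φ-pair-suc {i} 1≤i i<m = by-cases (b ∈? B)
    where
    open ≡-Reasoning
    b = m ∸ i
    1≤b : 1 ≤ b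
    1≤b = m<n⇒0<n∸m i<m
    b<m : b < m
    b<m = ∸-monoʳ-< 1≤i (<⇒≤ i<m)
    j≡m+b : m + m ∸ i ≡ m + b
    j≡m+b = +-∸-assoc m (<⇒≤ i<m)
    m≡i+b : m ≡ i + b
    m≡i+b = sym (m+[n∸m]≡n (<⇒≤ i<m))
    δ≡0 : pointMass 0 (m + m) i ≡ 0
    δ≡0 = pointMass-off 0 (m + m) {i} (<⇒≢ 1≤i ∘ sym)
    by-cases : Dec (b ∈ B) → partAt (Φ m B mid) i + partAt (Φ m B mid) (m + m ∸ i)
                              ≡ (i + pointMass 0 (m + m) i) + (partAt B b + partAt B b)
    by-cases (yes b∈) = begin
      partAt (Φ m B mid) i + partAt (Φ m B mid) (m + m ∸ i)
        ≡⟨ cong₂ _+_ (partAt-∉ (λ i∈ → Φ-lower⁻ i<m i∈ b∈))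
                     (partAt-∈ (subst (_∈ Φ m B mid) (sym j≡m+b) (Φ-upper⁺ 1≤b b<m b∈))) ⟩
      m + m ∸ i                                         ≡⟨ j≡m+b ⟩
      m + b                                             ≡⟨ cong (_+ b) m≡i+b ⟩
      i + b + b                                         ≡⟨ +-assoc i b b ⟩
      i + (b + b)                                       ≡⟨ sym (cong₂ _+_ (trans (cong (i +_) δ≡0) (+-identityʳ i))
                                                                         (cong₂ _+_ (partAt-∈ b∈) (partAt-∈ b∈))) ⟩
      (i + pointMass 0 (m + m) i) + (partAt B b + partAt B b) ∎
    by-cases (no b∉) = begin
      partAt (Φ m B mid) i + partAt (Φ m B mid) (m + m ∸ i)
        ≡⟨ cong₂ _+_ (partAt-∈ (Φ-lower⁺ 1≤i i<m b∉))
                     (partAt-∉ (λ j∈ → b∉ (Φ-upper⁻ 1≤b b<m (subst (_∈ Φ m B mid) j≡m+b j∈)))) ⟩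
      i + 0                                             ≡⟨ sym (+-identityʳ _) ⟩
      (i + 0) + (0 + 0)                                 ≡⟨ sym (cong₂ _+_ (cong (i +_) δ≡0) (cong₂ _+_ (partAt-∉ b∉) (partAt-∉ b∉))) ⟩
      (i + pointMass 0 (m + m) i) + (partAt B b + partAt B b) ∎

  Φ-pair : 1 ≤ m → All (_< m) B → ∀ i → i < m →
           partAt (Φ m B mid) i + partAt (Φ m B mid) (m + m ∸ i)
             ≡ (i + pointMass 0 (m + m) i) + (partAt B (m ∸ i) + partAt B (m ∸ i))
  Φ-pair 1≤m B<m zero    _   = Φ-pair-zero 1≤m B<m
  Φ-pair 1≤m B<m (suc i) i<m = Φ-pair-suc (s≤s z≤n) i<m

partAt-Φ-mid : ∀ m B mid → 1 ≤ m → partAt (Φ m B mid) m ≡ (if mid then m else 0)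
partAt-Φ-mid m B true  1≤m = partAt-∈ (ΦProperties.Φ-mid⁺ m B true 1≤m refl)
partAt-Φ-mid m B false 1≤m = partAt-∉ (λ m∈ → false≢true (ΦProperties.Φ-mid⁻ m B false 1≤m m∈))
  where
  false≢true : false ≢ true
  false≢true ()

module _ (m : ℕ) (B : List ℕ) (mid : Bool) where
  open ΦProperties m B mid

  largestPart-Φ : 1 ≤ m → largestPart (Φ m B mid) ≡ m + m
  largestPart-Φ 1≤m = largestPart-unique (Φ-top 1≤m) Φ-≤top

  sum-Φ : 1 ≤ m → Unique B → All (_< m) B →
          sum (Φ m B mid) ≡ (if mid then m else 0) + (Σ< m id + (m + m) + (sum B + sum B))
  sum-Φ 1≤m uniq B<m = begin
    sum (Φ m B mid)
      ≡⟨ sum≡Σ<partAt (suc (m + m)) _ (Linked<⇒Unique Φ-increasing) (All.tabulate (s≤s ∘ Φ-≤top)) ⟩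
    Σ< (suc (m + m)) (partAt (Φ m B mid))
      ≡⟨ Σ<-fold-even m _ ⟩
    partAt (Φ m B mid) m + Σ< m (λ i → partAt (Φ m B mid) i + partAt (Φ m B mid) (m + m ∸ i))
      ≡⟨ cong₂ _+_ (partAt-Φ-mid m B mid 1≤m) (Σ<-cong m (Φ-pair 1≤m B<m)) ⟩
    (if mid then m else 0) + Σ< m (λ i → (i + pointMass 0 (m + m) i) + (g i + g i))
      ≡⟨ cong ((if mid then m else 0) +_) (begin
        Σ< m (λ i → (i + pointMass 0 (m + m) i) + (g i + g i))
          ≡⟨ Σ<-+ m _ _ ⟩
        Σ< m (λ i → i + pointMass 0 (m + m) i) + Σ< m (λ i → g i + g i)
          ≡⟨ cong₂ _+_ (Σ<-+ m id _) (Σ<-+ m g g) ⟩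
        Σ< m id + Σ< m (pointMass 0 (m + m)) + (Σ< m g + Σ< m g)
          ≡⟨ cong₂ _+_ (cong (Σ< m id +_) (Σ<-pointMass m 0 (m + m) 1≤m))
                       (cong₂ _+_ (Σ<-partAt-reverse m B uniq B<m) (Σ<-partAt-reverse m B uniq B<m)) ⟩
        Σ< m id + (m + m) + (sum B + sum B) ∎) ⟩
    (if mid then m else 0) + (Σ< m id + (m + m) + (sum B + sum B)) ∎
    where
    open ≡-Reasoning
    g : ℕ → ℕ
    g i = partAt B (m ∸ i)

Φ-injective : ∀ {m B B′} mid → Linked _<_ B → Linked _<_ B′ →
              All (λ b → 1 ≤ b × b < m) B → All (λ b → 1 ≤ b × b < m) B′ → Φ m B mid ≡ Φ m B′ mid → B ≡ B′
Φ-injective {m} mid increasing increasing′ small small′ Φ≡Φ′ =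
  Linked<-ext increasing increasing′ (transfer small Φ≡Φ′) (transfer small′ (sym Φ≡Φ′))
  where
  transfer : ∀ {C C′} → All (λ b → 1 ≤ b × b < m) C → Φ m C mid ≡ Φ m C′ mid → ∀ {b} → b ∈ C → b ∈ C′
  transfer {C} {C′} small-C Φ≡ b∈ with 1≤b , b<m ← All.lookup small-C b∈ =
    ΦProperties.Φ-upper⁻ m C′ mid 1≤b b<m (subst (_ ∈_) Φ≡ (ΦProperties.Φ-upper⁺ m C mid 1≤b b<m b∈))

Φ[]-unrefinable : ∀ m → Unrefinable (Φ m [] true)
Φ[]-unrefinable m (a , b , _ , (1≤a , _ , a∉) , (1≤b , _ , b∉) , a+b∈) =
  <⇒≱ (+-mono-< (above a 1≤a a∉) (above b 1≤b b∉)) (Φ-≤top a+b∈)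
  where
  open ΦProperties m [] true
  above : ∀ c → 1 ≤ c → c ∉ Φ m [] true → m < c
  above c 1≤c c∉ with <-cmp c m
  ... | tri< c<m _ _  = ⊥-elim (c∉ (Φ-lower⁺ 1≤c c<m λ ()))
  ... | tri≈ _ refl _ = ⊥-elim (c∉ (Φ-mid⁺ 1≤c refl))
  ... | tri> _ _ m<c  = m<c

HasSize-filter : ∀ {P : Partition → Set} (P? : Decidable P) (candidates : List Partition) →
                 (∀ {ps} → P ps → ps ∈ candidates) → HasSize P (length (deduplicate (≡-dec _≟_) (filter P? candidates)))
HasSize-filter P? candidates complete =
  deduplicate (≡-dec _≟_) (filter P? candidates) , Uniqueₚ.deduplicate-! (≡-dec _≟_) _ ,
  (λ ps → mk⇔ (λ ps∈ → proj₂ (∈-filter⁻ P? {xs = candidates} (∈-deduplicate⁻ (≡-dec _≟_) (filter P? candidates) ps∈)))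
              (λ Pps → ∈-deduplicate⁺ (≡-dec _≟_) (∈-filter⁺ P? (complete Pps) Pps))) ,
  refl

HasSize-1+ : ∀ {P Q : Partition → Set} {d} (x : Partition) (f : Partition → Partition) →
             (∀ {B B′} → P B → P B′ → f B ≡ f B′ → B ≡ B′) → (∀ {B} → P B → f B ≢ x) →
             (∀ ps → Q ps ⇔ (ps ≡ x ⊎ ∃ λ B → P B × ps ≡ f B)) →
             HasSize P d → HasSize Q (1 + d)
HasSize-1+ {P} {Q} x f f-injective f≢x Q⇔ (Bs , Bs-unique , Bs-spec , refl) =
  x ∷ map f Bs , All.tabulate x∉ ∷ AllPairsₚ.map⁺ (injective-pairs Bs-unique (All.tabulate (Equivalence.to (Bs-spec _)))) ,
  (λ ps → mk⇔ (to ps) (from ps ∘ Equivalence.to (Q⇔ ps))) , cong suc (length-map f Bs)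
  where
  x∉ : ∀ {ps} → ps ∈ map f Bs → x ≢ ps
  x∉ ps∈ with B , B∈ , refl ← ∈-map⁻ f ps∈ = f≢x (Equivalence.to (Bs-spec B) B∈) ∘ sym
  injective-pairs : ∀ {Cs} → Unique Cs → All P Cs → AllPairs (λ B B′ → f B ≢ f B′) Cs
  injective-pairs []              []           = []
  injective-pairs (B∉ ∷ unique) (PB ∷ PCs) =
    All.zipWith (λ (B≢B′ , PB′) fB≡fB′ → B≢B′ (f-injective PB PB′ fB≡fB′)) (B∉ , PCs) ∷ injective-pairs unique PCs
  to : ∀ ps → ps ∈ x ∷ map f Bs → Q ps
  to ps (here refl) = Equivalence.from (Q⇔ ps) (inj₁ refl)
  to ps (there ps∈) with B , B∈ , refl ← ∈-map⁻ f ps∈ =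
    Equivalence.from (Q⇔ ps) (inj₂ (B , Equivalence.to (Bs-spec B) B∈ , refl))
  from : ∀ ps → ps ≡ x ⊎ (∃ λ B → P B × ps ≡ f B) → ps ∈ x ∷ map f Bs
  from ps (inj₁ refl)             = here refl
  from ps (inj₂ (B , PB , refl)) = there (∈-map⁺ f (Equivalence.from (Bs-spec B) PB))

listsBelow : ℕ → ℕ → List (List ℕ)
listsBelow zero    b = [] ∷ []
listsBelow (suc l) b = [] ∷ concatMap (λ x → map (x ∷_) (listsBelow l b)) (upTo b)

∈listsBelow : ∀ l b {xs} → length xs ≤ l → All (_< b) xs → xs ∈ listsBelow l b
∈listsBelow zero    b {[]}     _ _ = here refl
∈listsBelow (suc l) b {[]}     _ _ = here refl
∈listsBelow (suc l) b {x ∷ xs} (s≤s length≤l) (x<b ∷ xs<b) =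
  there (∈-concatMap⁺ (λ y → map (y ∷_) (listsBelow l b))
                      (Any.map (λ { refl → ∈-map⁺ (x ∷_) (∈listsBelow l b length≤l xs<b) }) (∈-upTo⁺ x<b)))

isDistinctPartition? : ∀ N → Decidable (IsDistinctPartition N)
isDistinctPartition? N ps = linked? _<?_ ps ×-dec all? (1 ≤?_) ps ×-dec sum ps ≟ N ×-dec 2 ≤? length ps

distinctPartitions : ℕ → List Partition
distinctPartitions N = deduplicate (≡-dec _≟_) (filter (isDistinctPartition? N) (listsBelow N (suc N)))

distinctPartitions-size : ∀ N → HasSize (IsDistinctPartition N) (length (distinctPartitions N))
distinctPartitions-size N = HasSize-filter (isDistinctPartition? N) (listsBelow N (suc N)) complete
  where
  complete : ∀ {ps} → IsDistinctPartition N ps → ps ∈ listsBelow N (suc N)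
  complete (_ , positive , refl , _) =
    ∈listsBelow _ _ (length≤sum positive) (All.tabulate (s≤s ∘ ∈⇒≤sum))

-- The maximal unrefinable partitions of T′ m k

T′ : ℕ → ℕ → ℕ
T′ m k = Σ< m id + (m + m) + (k + k)

record Admissible (m k : ℕ) (B : List ℕ) : Set where
  field
    increasing : Linked _<_ B
    positive   : All (1 ≤_) B
    sum≡k      : sum B ≡ k
    no-half    : ∀ {x} → x ∈ B → m ≢ x + x

module _ {m k : ℕ} (1≤k : 1 ≤ k) (2k≤m : k + k ≤ m) where

  1≤m : 1 ≤ m
  1≤m = ≤-trans 1≤k (≤-trans (m≤m+n k k) 2k≤m)

  k<m : k < m
  k<m = ≤-trans (≤-reflexive (+-comm 1 k)) (≤-trans (+-monoʳ-≤ k 1≤k) 2k≤m)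

  largestPart-≤ : ∀ {qs} → IsUnrefinablePartition (T′ m k) qs → largestPart qs ≤ m + m
  largestPart-≤ {qs} unrefinable with largestPart qs ≤? m + m
  ... | yes L≤2m = L≤2m
  ... | no  L≰2m = ⊥-elim (<-irrefl refl (begin-strict
    Σ< m id + (m + m) + m                   ≡⟨ reorder (Σ< m id) m ⟩
    m + m + (Σ< m id + m)                   <⟨ +-monoˡ-< _ (≰⇒> L≰2m) ⟩
    L + Σ< (suc m) id                       ≤⟨ +-monoʳ-≤ L (Σ<-monoˡ-≤ id 1+m≤⌈L/2⌉) ⟩
    L + Σ< ⌈ L /2⌉ id                       ≤⟨ unrefinable-sum-≥ unrefinable ⟩
    Σ< m id + (m + m) + (k + k)             ≤⟨ +-monoʳ-≤ (Σ< m id + (m + m)) 2k≤m ⟩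
    Σ< m id + (m + m) + m                   ∎))
    where
    open ≤-Reasoning
    L = largestPart qs
    1+m≤⌈L/2⌉ : suc m ≤ ⌈ L /2⌉
    1+m≤⌈L/2⌉ = subst (_≤ ⌈ L /2⌉) (cong suc (sym (n≡⌊n+n/2⌋ m))) (⌈n/2⌉-mono (≰⇒> L≰2m))
    reorder : ∀ s m → s + (m + m) + m ≡ m + m + (s + m)
    reorder = solve-∀

  module _ {B : List ℕ} (admissible : Admissible m k B) where
    open Admissible admissible
    open ΦProperties m B false

    ∈B⇒≤k : ∀ {x} → x ∈ B → x ≤ k
    ∈B⇒≤k x∈ = subst (_ ≤_) sum≡k (∈⇒≤sum x∈)

    ∈B⇒<m : ∀ {x} → x ∈ B → x < m
    ∈B⇒<m x∈ = ≤-<-trans (∈B⇒≤k x∈) k<m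

    ∈B₂⇒+<m : ∀ {x y} → x ∈ B → y ∈ B → x + y < m
    ∈B₂⇒+<m {x} {y} x∈ y∈ with x ≟ y
    ... | yes refl = ≤∧≢⇒< (≤-trans (+-mono-≤ (∈B⇒≤k x∈) (∈B⇒≤k x∈)) 2k≤m) (no-half x∈ ∘ sym)
    ... | no  x≢y  = ≤-<-trans (subst (_ ≤_) sum≡k (∈₂⇒+≤sum x∈ y∈ x≢y)) k<m

    ∈B₂⇒u+v+u<m : ∀ {u v} → u ∈ B → v ∈ B → u ≢ v → u + v + u < m
    ∈B₂⇒u+v+u<m {u} {v} u∈ v∈ u≢v = begin-strict
      u + v + u       ≡⟨ +-comm (u + v) u ⟩
      u + (u + v)     <⟨ +-monoˡ-< (u + v) (m<m+n u (All.lookup positive v∈)) ⟩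
      u + v + (u + v) ≤⟨ +-mono-≤ uv≤k uv≤k ⟩
      k + k           ≤⟨ 2k≤m ⟩
      m               ∎
      where
      open ≤-Reasoning
      uv≤k : u + v ≤ k
      uv≤k = subst (_ ≤_) sum≡k (∈₂⇒+≤sum u∈ v∈ u≢v)

    ∈B₃⇒+<m : ∀ {x x′ y} → x ∈ B → x′ ∈ B → y ∈ B → x ≢ x′ → x + x′ + y < m
    ∈B₃⇒+<m {x} {x′} {y} x∈ x′∈ y∈ x≢x′ with y ≟ x | y ≟ x′
    ... | yes refl | _        = ∈B₂⇒u+v+u<m x∈ x′∈ x≢x′
    ... | no y≢x   | yes refl = subst (_< m) (cong (_+ y) (+-comm y x)) (∈B₂⇒u+v+u<m x′∈ x∈ (x≢x′ ∘ sym))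
    ... | no y≢x   | no y≢x′  = ≤-<-trans (subst (_ ≤_) sum≡k (∈₃⇒+≤sum x∈ x′∈ y∈ x≢x′ (y≢x ∘ sym) (y≢x′ ∘ sym))) k<m

    MissingΦ : ℕ → Set
    MissingΦ a = (∃ λ x → x ∈ B × a + x ≡ m) ⊎ (∃ λ z → z ∉ B × a ≡ m + z)

    missing-Φ : ∀ {a} → Missing (Φ m B false) a → MissingΦ a
    missing-Φ {a} (1≤a , a≤L , a∉) with <-cmp a m
    ... | tri< a<m _ _ = below (m ∸ a ∈? B)
      where
      below : Dec (m ∸ a ∈ B) → MissingΦ a
      below (yes x∈) = inj₁ (m ∸ a , x∈ , m+[n∸m]≡n (<⇒≤ a<m))
      below (no  x∉) = ⊥-elim (a∉ (Φ-lower⁺ 1≤a a<m x∉))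
    ... | tri≈ _ refl _ = inj₂ (0 , (λ 0∈ → 1≰0 (All.lookup positive 0∈)) , sym (+-identityʳ m))
      where
      1≰0 : ¬ 1 ≤ 0
      1≰0 ()
    ... | tri> _ _ m<a = inj₂ (a ∸ m , z∉ , sym (m+[n∸m]≡n (<⇒≤ m<a)))
      where
      a<m+m : a < m + m
      a<m+m = ≤∧≢⇒< (subst (a ≤_) (largestPart-Φ m B false 1≤m) a≤L) (λ { refl → a∉ (Φ-top 1≤m) })
      z∉ : a ∸ m ∉ B
      z∉ z∈ = a∉ (subst (_∈ Φ m B false) (m+[n∸m]≡n (<⇒≤ m<a))
                   (Φ-upper⁺ (m<n⇒0<n∸m m<a) (subst (a ∸ m <_) (m+n∸n≡m m m) (∸-monoˡ-< a<m+m (<⇒≤ m<a))) z∈))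

    missing-Φ-≥ : ∀ {a} → MissingΦ a → m ≤ a + k
    missing-Φ-≥ {a} (inj₁ (x , x∈ , a+x≡m)) = subst (_≤ a + k) a+x≡m (+-monoʳ-≤ a (∈B⇒≤k x∈))
    missing-Φ-≥ {a} (inj₂ (z , _ , refl))   = ≤-trans (m≤m+n m z) (m≤m+n _ k)

    PartΦ : ℕ → Set
    PartΦ c = c < m ⊎ (∃ λ y → y ∈ B × c ≡ m + y) ⊎ c ≡ m + m

    part-Φ : ∀ {c} → c ∈ Φ m B false → PartΦ c
    part-Φ c∈ with Φ-part⁻ c∈
    ... | inj₁ (c<m , _)                      = inj₁ c<m
    ... | inj₂ (inj₁ (_ , ()))
    ... | inj₂ (inj₂ (inj₁ ((m<c , _) , y∈))) = inj₂ (inj₁ (_ , y∈ , sym (m+[n∸m]≡n (<⇒≤ m<c))))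
    ... | inj₂ (inj₂ (inj₂ c≡m+m))            = inj₂ (inj₂ c≡m+m)

    below<m : ∀ {a x} → x ∈ B → a + x ≡ m → a < m
    below<m {a} x∈ a+x≡m = subst (a <_) a+x≡m (m<m+n a (All.lookup positive x∈))

    small-refinement : ∀ {a b} → MissingΦ a → MissingΦ b → ¬ a + b < m
    small-refinement {a} {b} ca cb a+b<m = <-irrefl refl (begin-strict
      m + m           ≤⟨ +-mono-≤ (missing-Φ-≥ ca) (missing-Φ-≥ cb) ⟩
      a + k + (b + k) ≡⟨ interchange a k b k ⟩
      a + b + (k + k) <⟨ +-monoˡ-< (k + k) a+b<m ⟩
      m + (k + k)     ≤⟨ +-monoʳ-≤ m 2k≤m ⟩
      m + m           ∎)
      where open ≤-Reasoning

    top-above-above : ∀ {a b} → m ≤ a → m ≤ b → a + b ≡ m + m → a ≡ b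
    top-above-above {a} {b} m≤a m≤b a+b≡m+m = trans (≡m m≤a m≤b a+b≡m+m) (sym (≡m m≤b m≤a (trans (+-comm b a) a+b≡m+m)))
      where
      ≡m : ∀ {u v} → m ≤ u → m ≤ v → u + v ≡ m + m → u ≡ m
      ≡m {u} {v} m≤u m≤v u+v≡m+m =
        ≤-antisym (+-cancelʳ-≤ m u m (≤-trans (+-monoʳ-≤ u m≤v) (≤-reflexive u+v≡m+m))) m≤u

    top-below-above : ∀ {a b x z} → a + x ≡ m → b ≡ m + z → a + b ≡ m + m → z ≡ x
    top-below-above {a} {b} {x} {z} a+x≡m refl a+b≡m+m = +-cancelˡ-≡ (a + m) z x (begin
      a + m + z   ≡⟨ +-assoc a m z ⟩
      a + (m + z) ≡⟨ a+b≡m+m ⟩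
      m + m       ≡⟨ cong (_+ m) (sym a+x≡m) ⟩
      a + x + m   ≡⟨ xy∙z≈xz∙y a x m ⟩
      a + m + x   ∎)
      where open ≡-Reasoning

    middle-below-above : ∀ {a b x y z} → a + x ≡ m → b ≡ m + z → a + b ≡ m + y → m + z ≡ x + y
    middle-below-above {a} {b} {x} {y} {z} a+x≡m refl a+b≡m+y = +-cancelˡ-≡ m _ _ (begin
      m + (m + z)       ≡⟨ cong (_+ (m + z)) (sym a+x≡m) ⟩
      a + x + (m + z)   ≡⟨ xy∙z≈y∙xz a x (m + z) ⟩
      x + (a + (m + z)) ≡⟨ cong (x +_) a+b≡m+y ⟩
      x + (m + y)       ≡⟨ x∙yz≈y∙xz x m y ⟩
      m + (x + y)       ∎)
      where open ≡-Reasoning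

    middle-below-below : ∀ {a b x x′ y} → a + x ≡ m → b + x′ ≡ m → a + b ≡ m + y → x + x′ + y ≡ m
    middle-below-below {a} {b} {x} {x′} {y} a+x≡m b+x′≡m a+b≡m+y = +-cancelˡ-≡ m _ _ (begin
      m + (x + x′ + y)     ≡⟨ +-comm m _ ⟩
      x + x′ + y + m       ≡⟨ xy∙z≈xz∙y (x + x′) y m ⟩
      x + x′ + m + y       ≡⟨ +-assoc (x + x′) m y ⟩
      x + x′ + (m + y)     ≡⟨ cong (x + x′ +_) (sym a+b≡m+y) ⟩
      x + x′ + (a + b)     ≡⟨ +-comm (x + x′) (a + b) ⟩
      a + b + (x + x′)     ≡⟨ interchange a b x x′ ⟩
      a + x + (b + x′)     ≡⟨ cong₂ _+_ a+x≡m b+x′≡m ⟩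
      m + m                ∎)
      where open ≡-Reasoning

    Φ-unrefinable : Unrefinable (Φ m B false)
    Φ-unrefinable (a , b , a≢b , a-missing , b-missing , a+b∈) =
      refute (missing-Φ a-missing) (missing-Φ b-missing) (part-Φ a+b∈)
      where
      b+a≡a+b = +-comm b a
      refute : MissingΦ a → MissingΦ b → PartΦ (a + b) → ⊥
      refute ca cb (inj₁ a+b<m) = small-refinement ca cb a+b<m
      refute (inj₁ (x , x∈ , a+x≡m)) (inj₁ (x′ , x′∈ , b+x′≡m)) (inj₂ (inj₂ top)) =
        <-irrefl top (+-mono-< (below<m x∈ a+x≡m) (below<m x′∈ b+x′≡m))
      refute (inj₁ (x , x∈ , a+x≡m)) (inj₂ (z , z∉ , b≡m+z)) (inj₂ (inj₂ top)) =
        z∉ (subst (_∈ B) (sym (top-below-above a+x≡m b≡m+z top)) x∈)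
      refute (inj₂ (z , z∉ , a≡m+z)) (inj₁ (x , x∈ , b+x≡m)) (inj₂ (inj₂ top)) =
        z∉ (subst (_∈ B) (sym (top-below-above b+x≡m a≡m+z (trans b+a≡a+b top))) x∈)
      refute (inj₂ (z , _ , refl)) (inj₂ (z′ , _ , refl)) (inj₂ (inj₂ top)) =
        a≢b (top-above-above (m≤m+n m z) (m≤m+n m z′) top)
      refute (inj₁ (x , x∈ , a+x≡m)) (inj₁ (x′ , x′∈ , b+x′≡m)) (inj₂ (inj₁ (y , y∈ , middle))) =
        <-irrefl (middle-below-below {a} {b} a+x≡m b+x′≡m middle) (∈B₃⇒+<m x∈ x′∈ y∈ x≢x′)
        where
        x≢x′ : x ≢ x′
        x≢x′ refl = a≢b (+-cancelʳ-≡ x a b (trans a+x≡m (sym b+x′≡m)))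
      refute (inj₁ (x , x∈ , a+x≡m)) (inj₂ (z , _ , b≡m+z)) (inj₂ (inj₁ (y , y∈ , middle))) =
        <⇒≱ (∈B₂⇒+<m x∈ y∈) (subst (m ≤_) (middle-below-above a+x≡m b≡m+z middle) (m≤m+n m z))
      refute (inj₂ (z , _ , a≡m+z)) (inj₁ (x , x∈ , b+x≡m)) (inj₂ (inj₁ (y , y∈ , middle))) =
        <⇒≱ (∈B₂⇒+<m x∈ y∈) (subst (m ≤_) (middle-below-above b+x≡m a≡m+z (trans b+a≡a+b middle)) (m≤m+n m z))
      refute (inj₂ (z , _ , refl)) (inj₂ (z′ , _ , refl)) (inj₂ (inj₁ (y , y∈ , middle))) =
        <⇒≱ (+-monoʳ-< m (∈B⇒<m y∈)) (≤-trans (+-mono-≤ (m≤m+n m z) (m≤m+n m z′)) (≤-reflexive middle))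

  largestPart≡⇒maximal : ∀ {ps} → IsUnrefinablePartition (T′ m k) ps → largestPart ps ≡ m + m →
                            IsMaximalUnrefinable (T′ m k) ps
  largestPart≡⇒maximal unrefinable L≡m+m =
    unrefinable , λ _ q → ≤-trans (largestPart-≤ q) (≤-reflexive (sym L≡m+m))

  Φ-maximal : ∀ {B mid} → Unrefinable (Φ m B mid) → sum (Φ m B mid) ≡ T′ m k →
              IsMaximalUnrefinable (T′ m k) (Φ m B mid)
  Φ-maximal {B} {mid} unrefinable sum≡T′ =
    largestPart≡⇒maximal ((Φ-increasing , Φ-positive , sum≡T′ , two-parts) , unrefinable) (largestPart-Φ m B mid 1≤m)
    where
    open ΦProperties m B mid
    two-parts : 2 ≤ length (Φ m B mid)
    two-parts = largestPart<sum⇒2≤length (Φ m B mid) (begin-strict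
      largestPart (Φ m B mid)         ≡⟨ largestPart-Φ m B mid 1≤m ⟩
      m + m                           <⟨ m<m+n (m + m) (≤-trans 1≤k (m≤m+n k k)) ⟩
      m + m + (k + k)                 ≤⟨ +-monoˡ-≤ (k + k) (m≤n+m (m + m) (Σ< m id)) ⟩
      Σ< m id + (m + m) + (k + k)     ≡⟨ sym sum≡T′ ⟩
      sum (Φ m B mid)                 ∎)
      where open ≤-Reasoning

  Φ-admissible-maximal : ∀ {B} → Admissible m k B → IsMaximalUnrefinable (T′ m k) (Φ m B false)
  Φ-admissible-maximal {B} admissible = Φ-maximal (Φ-unrefinable admissible) (begin
    sum (Φ m B false)                    ≡⟨ sum-Φ m B false 1≤m (Linked<⇒Unique increasing) (All.tabulate (∈B⇒<m admissible)) ⟩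
    Σ< m id + (m + m) + (sum B + sum B)  ≡⟨ cong (λ s → Σ< m id + (m + m) + (s + s)) sum≡k ⟩
    T′ m k                               ∎)
    where
    open ≡-Reasoning
    open Admissible admissible

  Φ[]-maximal : m ≡ k + k → IsMaximalUnrefinable (T′ m k) (Φ m [] true)
  Φ[]-maximal m≡k+k = Φ-maximal (Φ[]-unrefinable m) (begin
    sum (Φ m [] true)                ≡⟨ sum-Φ m [] true 1≤m [] [] ⟩
    m + (Σ< m id + (m + m) + 0)      ≡⟨ +-comm m _ ⟩
    Σ< m id + (m + m) + 0 + m        ≡⟨ cong₂ _+_ (+-identityʳ _) m≡k+k ⟩
    T′ m k                           ∎)
    where open ≡-Reasoning

  singleton-admissible : m ≢ k + k → Admissible m k (k ∷ [])
  singleton-admissible m≢k+k = record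
    { increasing = [-]
    ; positive   = 1≤k ∷ []
    ; sum≡k      = +-identityʳ k
    ; no-half    = λ { (here refl) → m≢k+k }
    }

  largestPart-maximal : ∀ {ps} → IsMaximalUnrefinable (T′ m k) ps → largestPart ps ≡ m + m
  largestPart-maximal {ps} (unrefinable , largest) = ≤-antisym (largestPart-≤ unrefinable) (witness (m ≟ k + k))
    where
    witness : Dec (m ≡ k + k) → m + m ≤ largestPart ps
    witness (yes m≡k+k) = subst (_≤ _) (largestPart-Φ m [] true 1≤m)
                                (largest _ (proj₁ (Φ[]-maximal m≡k+k)))
    witness (no  m≢k+k) = subst (_≤ _) (largestPart-Φ m (k ∷ []) false 1≤m)
                                (largest _ (proj₁ (Φ-admissible-maximal (singleton-admissible m≢k+k))))

  module _ {ps : List ℕ} (maximal : IsMaximalUnrefinable (T′ m k) ps) where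
    private
      distinct    = proj₁ (proj₁ maximal)
      unrefinable = proj₂ (proj₁ maximal)
      L≡m+m       = largestPart-maximal maximal

    top∈ps : m + m ∈ ps
    top∈ps = subst (_∈ ps) L≡m+m (largestPart∈ distinct)

    ∈ps⇒≤top : ∀ {j} → j ∈ ps → j ≤ m + m
    ∈ps⇒≤top j∈ = subst (_ ≤_) L≡m+m (∈⇒≤largestPart j∈)

    ∈ps⇒positive : ∀ {j} → j ∈ ps → 1 ≤ j
    ∈ps⇒positive = All.lookup (proj₁ (proj₂ distinct))

    sum-ps : Σ< (suc (m + m)) (partAt ps) ≡ T′ m k
    sum-ps = trans (cong (λ L → Σ< (suc L) (partAt ps)) (sym L≡m+m))
                   (trans (sym (sum≡Σ<partAt-largestPart distinct)) (proj₁ (proj₂ (proj₂ distinct))))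

    m+m∸i≡m+[m∸i] : ∀ {i} → i < m → m + m ∸ i ≡ m + (m ∸ i)
    m+m∸i≡m+[m∸i] i<m = +-∸-assoc m (<⇒≤ i<m)

    lower⊎upper : ∀ {i} → 1 ≤ i → i < m → i ∈ ps ⊎ m + (m ∸ i) ∈ ps
    lower⊎upper {i} 1≤i i<m with ∈⊎complement∈ unrefinable top∈ps 1≤i i<m+m∸i
      where
      i<m+m∸i : i < m + m ∸ i
      i<m+m∸i = subst (i <_) (sym (m+m∸i≡m+[m∸i] i<m)) (≤-trans i<m (m≤m+n m _))
    ... | inj₁ i∈ = inj₁ i∈
    ... | inj₂ j∈ = inj₂ (subst (_∈ ps) (m+m∸i≡m+[m∸i] i<m) j∈)

    ¬lower×upper : ∀ {i} → 1 ≤ i → i < m → i ∈ ps → m + (m ∸ i) ∈ ps → ⊥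
    ¬lower×upper {i} 1≤i i<m i∈ j∈ = <⇒≱ m<j (≤-trans (+-cancelˡ-≤ (Σ< m id + (m + m)) _ _ bound) 2k≤m)
      where
      open ≤-Reasoning
      j = m + (m ∸ i)
      m<j : m < j
      m<j = m<m+n m (m<n⇒0<n∸m i<m)
      pairs : ℕ → ℕ
      pairs i′ = partAt ps i′ + partAt ps (m + m ∸ i′)
      Σ<-lower : Σ< m (λ i′ → i′ + pointMass 0 (m + m) i′) ≡ Σ< m id + (m + m)
      Σ<-lower = trans (Σ<-+ m id _) (cong (Σ< m id +_) (Σ<-pointMass m 0 (m + m) 1≤m))
      at-i : i + pointMass 0 (m + m) i + j ≤ pairs i
      at-i = ≤-reflexive (begin-equality
        i + pointMass 0 (m + m) i + j ≡⟨ cong (λ t → i + t + j) (pointMass-off 0 (m + m) (λ i≡0 → <⇒≢ 1≤i (sym i≡0))) ⟩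
        i + 0 + j                     ≡⟨ cong₂ _+_ (+-identityʳ i) (sym (m+m∸i≡m+[m∸i] i<m)) ⟩
        i + (m + m ∸ i)               ≡⟨ sym (cong₂ _+_ (partAt-∈ i∈) (partAt-∈ (subst (_∈ ps) (sym (m+m∸i≡m+[m∸i] i<m)) j∈))) ⟩
        pairs i                       ∎)
      bound : Σ< m id + (m + m) + j ≤ Σ< m id + (m + m) + (k + k)
      bound = begin
        Σ< m id + (m + m) + j                          ≡⟨ cong (_+ j) (sym Σ<-lower) ⟩
        Σ< m (λ i′ → i′ + pointMass 0 (m + m) i′) + j  ≤⟨ Σ<-mono-≤-+ m (λ i′ i′<m → partAt-pair-≥ unrefinable top∈ps i′ (+-mono-< i′<m i′<m)) i<m at-i ⟩
        Σ< m pairs                                     ≤⟨ m≤n+m _ (partAt ps m) ⟩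
        partAt ps m + Σ< m pairs                       ≡⟨ sym (Σ<-fold-even m (partAt ps)) ⟩
        Σ< (suc (m + m)) (partAt ps)                   ≡⟨ sum-ps ⟩
        T′ m k                                         ∎

    upperDiffs : List ℕ
    upperDiffs = Interval.list (pred m) (λ b → m + b ∈? ps)

    ∈upperDiffs⁺ : ∀ {b} → 1 ≤ b → b < m → m + b ∈ ps → b ∈ upperDiffs
    ∈upperDiffs⁺ 1≤b b<m = Interval.∈-list⁺ (pred m) (λ b → m + b ∈? ps) 1≤b (<⇒≤pred b<m)

    ∈upperDiffs⁻ : ∀ {b} → b ∈ upperDiffs → 1 ≤ b × b < m × m + b ∈ ps
    ∈upperDiffs⁻ b∈ with Interval.∈-list⁻ (pred m) (λ b → m + b ∈? ps) b∈
    ... | 1≤b , b≤pred[m] , m+b∈ = 1≤b , m≤pred[n]⇒suc[m]≤n {{>-nonZero 1≤m}} b≤pred[m] , m+b∈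

    ps≡Φ : ∀ mid → (m ∈ ps → mid ≡ true) → (mid ≡ true → m ∈ ps) → ps ≡ Φ m upperDiffs mid
    ps≡Φ mid to-mid from-mid = Linked<-ext (proj₁ distinct) Φ-increasing ⊆ ⊇
      where
      open ΦProperties m upperDiffs mid
      upper : ∀ {j} → m < j → j < m + m → j ∈ ps → j ∈ Φ m upperDiffs mid
      upper {j} m<j j<m+m j∈ = subst (_∈ Φ m upperDiffs mid) m+[j∸m]≡j
        (Φ-upper⁺ 1≤j∸m j∸m<m (∈upperDiffs⁺ 1≤j∸m j∸m<m (subst (_∈ ps) (sym m+[j∸m]≡j) j∈)))
        where
        m+[j∸m]≡j = m+[n∸m]≡n (<⇒≤ m<j)
        1≤j∸m = m<n⇒0<n∸m m<j
        j∸m<m = subst (j ∸ m <_) (m+n∸n≡m m m) (∸-monoˡ-< j<m+m (<⇒≤ m<j))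
      ⊆ : ∀ {j} → j ∈ ps → j ∈ Φ m upperDiffs mid
      ⊆ {j} j∈ with <-cmp j m | j ≟ m + m
      ... | tri< j<m _ _  | _         = Φ-lower⁺ (∈ps⇒positive j∈) j<m
                                          (¬lower×upper (∈ps⇒positive j∈) j<m j∈ ∘ proj₂ ∘ proj₂ ∘ ∈upperDiffs⁻)
      ... | tri≈ _ refl _ | _         = Φ-mid⁺ 1≤m (to-mid j∈)
      ... | tri> _ _ _    | yes refl  = Φ-top 1≤m
      ... | tri> _ _ m<j  | no j≢m+m  = upper m<j (≤∧≢⇒< (∈ps⇒≤top j∈) j≢m+m) j∈
      lower : ∀ {j} → 1 ≤ j → j < m → m ∸ j ∉ upperDiffs → j ∈ ps ⊎ m + (m ∸ j) ∈ ps → j ∈ ps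
      lower _   _   _    (inj₁ j∈) = j∈
      lower 1≤j j<m m∸j∉ (inj₂ u∈) = ⊥-elim (m∸j∉ (∈upperDiffs⁺ (m<n⇒0<n∸m j<m) (∸-monoʳ-< 1≤j (<⇒≤ j<m)) u∈))
      ⊇ : ∀ {j} → j ∈ Φ m upperDiffs mid → j ∈ ps
      ⊇ {j} j∈ with Φ-part⁻ j∈
      ... | inj₁ (j<m , m∸j∉) = lower 1≤j j<m m∸j∉ (lower⊎upper 1≤j j<m)
        where
        1≤j = All.lookup Φ-positive j∈
      ... | inj₂ (inj₁ (refl , mid≡true))          = from-mid mid≡true
      ... | inj₂ (inj₂ (inj₁ ((m<j , _) , j∸m∈))) =
        subst (_∈ ps) (m+[n∸m]≡n (<⇒≤ m<j)) (proj₂ (proj₂ (∈upperDiffs⁻ j∸m∈)))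
      ... | inj₂ (inj₂ (inj₂ refl))                = top∈ps

    private
      upperDiffs-unique : Unique upperDiffs
      upperDiffs-unique = Linked<⇒Unique (Interval.list-increasing (pred m) (λ b → m + b ∈? ps))

      upperDiffs-<m : All (_< m) upperDiffs
      upperDiffs-<m = All.tabulate (proj₁ ∘ proj₂ ∘ ∈upperDiffs⁻)

    mid+2sum≡2k : ∀ mid → ps ≡ Φ m upperDiffs mid →
                  (if mid then m else 0) + (sum upperDiffs + sum upperDiffs) ≡ k + k
    mid+2sum≡2k mid ps≡Φ = +-cancelˡ-≡ (Σ< m id + (m + m)) _ _ (begin
      Σ< m id + (m + m) + ((if mid then m else 0) + (sum upperDiffs + sum upperDiffs))
        ≡⟨ x∙yz≈y∙xz (Σ< m id + (m + m)) (if mid then m else 0) _ ⟩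
      (if mid then m else 0) + (Σ< m id + (m + m) + (sum upperDiffs + sum upperDiffs))
        ≡⟨ sym (sum-Φ m upperDiffs mid 1≤m upperDiffs-unique upperDiffs-<m) ⟩
      sum (Φ m upperDiffs mid)
        ≡⟨ cong sum (sym ps≡Φ) ⟩
      sum ps
        ≡⟨ proj₁ (proj₂ (proj₂ distinct)) ⟩
      T′ m k ∎)
      where open ≡-Reasoning

    maximal-with-mid : m ∈ ps → m ≡ k + k × ps ≡ Φ m [] true
    maximal-with-mid m∈ = m≡k+k , trans ps≡Φ-true (cong (λ A → Φ m A true) upperDiffs≡[])
      where
      ps≡Φ-true = ps≡Φ true (λ _ → refl) (λ _ → m∈)
      m+2sum≡2k = mid+2sum≡2k true ps≡Φ-true
      2sum≡0 : sum upperDiffs + sum upperDiffs ≡ 0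
      2sum≡0 = n≤0⇒n≡0 (+-cancelˡ-≤ m _ 0
                 (≤-trans (≤-reflexive m+2sum≡2k) (≤-trans 2k≤m (≤-reflexive (sym (+-identityʳ m))))))
      m≡k+k : m ≡ k + k
      m≡k+k = trans (sym (+-identityʳ m)) (trans (cong (m +_) (sym 2sum≡0)) m+2sum≡2k)
      upperDiffs≡[] : upperDiffs ≡ []
      upperDiffs≡[] = positive-sum≡0⇒[] upperDiffs (Interval.list-positive (pred m) (λ b → m + b ∈? ps))
                                        (m+n≡0⇒m≡0 _ 2sum≡0)

    maximal-without-mid : m ∉ ps → ∃ λ A → Admissible m k A × ps ≡ Φ m A false
    maximal-without-mid m∉ = upperDiffs , admissible , ps≡Φ-false
      where
      ps≡Φ-false = ps≡Φ false (⊥-elim ∘ m∉) (λ ())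
      no-half : ∀ {x} → x ∈ upperDiffs → m ≢ x + x
      no-half {x} x∈ m≡x+x = unrefinable (x , m , <⇒≢ x<m ,
          (1≤x , ≤-trans (<⇒≤ x<m) m≤L , x∉ps) , (1≤m , m≤L , m∉) , subst (_∈ ps) (+-comm m x) m+x∈)
        where
        1≤x = proj₁ (∈upperDiffs⁻ x∈)
        x<m = proj₁ (proj₂ (∈upperDiffs⁻ x∈))
        m+x∈ = proj₂ (proj₂ (∈upperDiffs⁻ x∈))
        m≤L : m ≤ largestPart ps
        m≤L = subst (m ≤_) (sym L≡m+m) (m≤m+n m m)
        x∉ps : x ∉ ps
        x∉ps x∈ps = ¬lower×upper 1≤x x<m x∈ps
          (subst (λ t → m + t ∈ ps) (sym (trans (cong (_∸ x) m≡x+x) (m+n∸n≡m x x))) m+x∈)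
      admissible : Admissible m k upperDiffs
      admissible = record
        { increasing = Interval.list-increasing (pred m) (λ b → m + b ∈? ps)
        ; positive   = Interval.list-positive (pred m) (λ b → m + b ∈? ps)
        ; sum≡k      = trans (n≡⌊n+n/2⌋ _) (trans (cong ⌊_/2⌋ (mid+2sum≡2k false ps≡Φ-false)) (sym (n≡⌊n+n/2⌋ k)))
        ; no-half    = no-half
        }

  distinct⇒small : ∀ {B} → IsDistinctPartition k B → All (λ b → 1 ≤ b × b < m) B
  distinct⇒small (_ , positive , refl , _) = All.tabulate (λ b∈ → All.lookup positive b∈ , ≤-<-trans (∈⇒≤sum b∈) k<m)

  distinct⇒admissible : ∀ {B} → IsDistinctPartition k B → Admissible m k B
  distinct⇒admissible {B} (increasing , positive , sum≡k , 2≤length) = record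
    { increasing = increasing
    ; positive   = positive
    ; sum≡k      = sum≡k
    ; no-half    = no-half
    }
    where
    no-half : ∀ {x} → x ∈ B → m ≢ x + x
    no-half {x} x∈ m≡x+x with y , y∈ , x≢y ← ∈-other (Linked<⇒Unique increasing) 2≤length x∈ =
      <-irrefl (sym m≡x+x) (≤-trans (+-mono-< x<k x<k) 2k≤m)
      where
      x<k : x < k
      x<k = ≤-trans (m<m+n x (All.lookup positive y∈)) (subst (x + y ≤_) sum≡k (∈₂⇒+≤sum x∈ y∈ x≢y))

  admissible⇒singleton⊎distinct : ∀ {B} → Admissible m k B → B ≡ k ∷ [] ⊎ IsDistinctPartition k B
  admissible⇒singleton⊎distinct {[]}        admissible = ⊥-elim (<⇒≢ 1≤k (Admissible.sum≡k admissible))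
  admissible⇒singleton⊎distinct {x ∷ []}    admissible =
    inj₁ (cong (_∷ []) (trans (sym (+-identityʳ x)) (Admissible.sum≡k admissible)))
  admissible⇒singleton⊎distinct {_ ∷ _ ∷ _} admissible =
    inj₂ (increasing , positive , sum≡k , s≤s (s≤s z≤n))
    where open Admissible admissible

  m∉Φ : ∀ B → m ∉ Φ m B false
  m∉Φ B m∈ with () ← ΦProperties.Φ-mid⁻ m B false 1≤m m∈

  Φ-injective-on-distinct : ∀ {B B′} → IsDistinctPartition k B → IsDistinctPartition k B′ →
                            Φ m B false ≡ Φ m B′ false → B ≡ B′
  Φ-injective-on-distinct D D′ = Φ-injective false (proj₁ D) (proj₁ D′) (distinct⇒small D) (distinct⇒small D′)

  IsΦOfDistinct : Partition → Set
  IsΦOfDistinct ps = ∃ λ B → IsDistinctPartition k B × ps ≡ Φ m B false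

  maximal⇔ : ∀ {x} → IsMaximalUnrefinable (T′ m k) x →
             (∀ {ps} → IsMaximalUnrefinable (T′ m k) ps → ps ≡ x ⊎ IsΦOfDistinct ps) →
             ∀ ps → IsMaximalUnrefinable (T′ m k) ps ⇔ (ps ≡ x ⊎ IsΦOfDistinct ps)
  maximal⇔ x-maximal classify ps = mk⇔ classify λ
    { (inj₁ refl)            → x-maximal
    ; (inj₂ (_ , D , refl)) → Φ-admissible-maximal (distinct⇒admissible D)
    }

  classify-when-m≡k+k : m ≡ k + k → ∀ {ps} → IsMaximalUnrefinable (T′ m k) ps → ps ≡ Φ m [] true ⊎ IsΦOfDistinct ps
  classify-when-m≡k+k m≡k+k {ps} maximal with m ∈? ps
  ... | yes m∈ = inj₁ (proj₂ (maximal-with-mid maximal m∈))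
  ... | no  m∉ with A , admissible , ps≡ ← maximal-without-mid maximal m∉
                | admissible⇒singleton⊎distinct admissible
  ...   | inj₁ refl = ⊥-elim (Admissible.no-half admissible (here refl) m≡k+k)
  ...   | inj₂ D    = inj₂ (A , D , ps≡)

  classify-when-m≢k+k : m ≢ k + k → ∀ {ps} → IsMaximalUnrefinable (T′ m k) ps → ps ≡ Φ m (k ∷ []) false ⊎ IsΦOfDistinct ps
  classify-when-m≢k+k m≢k+k {ps} maximal with m ∈? ps
  ... | yes m∈ = ⊥-elim (m≢k+k (proj₁ (maximal-with-mid maximal m∈)))
  ... | no  m∉ with A , admissible , ps≡ ← maximal-without-mid maximal m∉
                | admissible⇒singleton⊎distinct admissible
  ...   | inj₁ refl = inj₁ ps≡
  ...   | inj₂ D    = inj₂ (A , D , ps≡)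

  maximal-count : ∀ {d} → HasSize (IsDistinctPartition k) d → HasSize (IsMaximalUnrefinable (T′ m k)) (1 + d)
  maximal-count with m ≟ k + k
  ... | yes m≡k+k = HasSize-1+ (Φ m [] true) (λ B → Φ m B false) Φ-injective-on-distinct
      (λ {B} _ Φ≡ → m∉Φ B (subst (m ∈_) (sym Φ≡) (ΦProperties.Φ-mid⁺ m [] true 1≤m refl)))
      (maximal⇔ (Φ[]-maximal m≡k+k) (classify-when-m≡k+k m≡k+k))
  ... | no m≢k+k = HasSize-1+ (Φ m (k ∷ []) false) (λ B → Φ m B false) Φ-injective-on-distinct
      (λ D Φ≡ → singleton-not-distinct D (Φ-injective false (proj₁ D) [-] (distinct⇒small D) ((1≤k , k<m) ∷ []) Φ≡))
      (maximal⇔ (Φ-admissible-maximal (singleton-admissible m≢k+k)) (classify-when-m≢k+k m≢k+k))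
    where
    singleton-not-distinct : ∀ {B} → IsDistinctPartition k B → B ≢ k ∷ []
    singleton-not-distinct (_ , _ , _ , s≤s ()) refl

triangle : ∀ n → n * suc n / 2 ≡ Σ< (suc n) id
triangle n = trans (cong (_/ 2) (sym (Σ<-id-*2 n))) (m*n/n≡m (Σ< (suc n) id) 2)

T≡T′ : ∀ m k d → d + (k + k) ≡ 3 + m → T (2 + m) d ≡ T′ m k
T≡T′ m k d d+2k≡3+m = begin
  T (2 + m) d                                   ≡⟨ cong (_∸ d) (triangle (2 + m)) ⟩
  Σ< m id + m + suc m + suc (suc m) ∸ d         ≡⟨ cong (_∸ d) (regroup (Σ< m id) m) ⟩
  Σ< m id + (m + m) + (3 + m) ∸ d               ≡⟨ cong (λ t → Σ< m id + (m + m) + t ∸ d) (sym d+2k≡3+m) ⟩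
  Σ< m id + (m + m) + (d + (k + k)) ∸ d         ≡⟨ cong (_∸ d) (x∙yz≈xz∙y (Σ< m id + (m + m)) d (k + k)) ⟩
  T′ m k + d ∸ d                                ≡⟨ m+n∸n≡m (T′ m k) d ⟩
  T′ m k                                        ∎
  where
  open ≡-Reasoning
  regroup : ∀ s m → s + m + suc m + suc (suc m) ≡ s + (m + m) + (3 + m)
  regroup = solve-∀

hypotheses⇒shape : ∀ n k d → 1 ≤ k → d ≡ n ∸ (2 * k ∸ 1) → 3 ≤ d → ∃ λ m → n ≡ 2 + m × d + (k + k) ≡ 3 + m
hypotheses⇒shape n k d 1≤k refl 3≤d = n ∸ 2 , sym (m+[n∸m]≡n 2≤n) , d+2k≡3+[n∸2]
  where
  2k∸1≤n : 2 * k ∸ 1 ≤ n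
  2k∸1≤n with 2 * k ∸ 1 ≤? n
  ... | yes ≤n = ≤n
  ... | no  ≰n = ⊥-elim (<⇒≢ (≤-trans (s≤s z≤n) 3≤d) (sym (m≤n⇒m∸n≡0 (<⇒≤ (≰⇒> ≰n)))))
  2k≡[2k∸1]+1 : k + k ≡ 2 * k ∸ 1 + 1
  2k≡[2k∸1]+1 = sym (trans (m∸n+n≡m (≤-trans 1≤k (m≤m+n k _))) (cong (k +_) (+-identityʳ k)))
  d+2k≡1+n : n ∸ (2 * k ∸ 1) + (k + k) ≡ suc n
  d+2k≡1+n = begin
    n ∸ (2 * k ∸ 1) + (k + k)             ≡⟨ cong (n ∸ (2 * k ∸ 1) +_) 2k≡[2k∸1]+1 ⟩
    n ∸ (2 * k ∸ 1) + (2 * k ∸ 1 + 1)     ≡⟨ sym (+-assoc (n ∸ (2 * k ∸ 1)) _ 1) ⟩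
    n ∸ (2 * k ∸ 1) + (2 * k ∸ 1) + 1     ≡⟨ cong (_+ 1) (m∸n+n≡m 2k∸1≤n) ⟩
    n + 1                                 ≡⟨ +-comm n 1 ⟩
    suc n                                 ∎
    where open ≡-Reasoning
  2≤n : 2 ≤ n
  2≤n = ≤-trans (s≤s (s≤s z≤n)) (≤-pred (≤-trans (+-mono-≤ 3≤d (+-mono-≤ 1≤k 1≤k)) (≤-reflexive d+2k≡1+n)))
  d+2k≡3+[n∸2] : n ∸ (2 * k ∸ 1) + (k + k) ≡ 3 + (n ∸ 2)
  d+2k≡3+[n∸2] = trans d+2k≡1+n (cong suc (sym (m+[n∸m]≡n 2≤n)))

theorem3p11 : (n k d : ℕ) → 11 ≤ n → 1 ≤ k → d ≡ n ∸ (2 * k ∸ 1) → 3 ≤ d → d ≤ n ∸ 7 →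
    Σ ℕ (λ m → HasSize (IsDistinctPartition k) m × HasSize (IsMaximalUnrefinable (T n d)) (1 + m))
theorem3p11 n k d _ 1≤k d≡ 3≤d _ with hypotheses⇒shape n k d 1≤k d≡ 3≤d
... | m , refl , d+2k≡3+m =
  length (distinctPartitions k) , distinctPartitions-size k ,
  subst (λ N → HasSize (IsMaximalUnrefinable N) (1 + length (distinctPartitions k))) (sym (T≡T′ m k d d+2k≡3+m))
        (maximal-count 1≤k 2k≤m (distinctPartitions-size k))
  where
  2k≤m : k + k ≤ m
  2k≤m = +-cancelˡ-≤ 3 _ _ (≤-trans (+-monoˡ-≤ (k + k) 3≤d) (≤-reflexive d+2k≡3+m))
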